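{- In the stratified type and effect system: (1) For every region context $R$, closed term $M$, type $A$ and effect $e$, the judgement $R;\emptyset\vdash M:(A,e)$ is derivable if and only if $R\vdash M\in[\![R\vdash(A,e)]\!]$. (2) If $R;\emptyset\vdash M_1,\ldots,M_n:(\mathbf B,e)$ is derivable, then the program $M_1,\ldots,M_n$ terminates, i.e. every reduction sequence starting from it is finite.
   Context: Syntax. Regions $r,s,\ldots$; effects $e$ are finite sets of regions. Types: $A ::= \mathbf{1} \mid \mathrm{Reg}_r A \mid A\xrightarrow{e}A$. Region contexts $R=r_1:A_1,\ldots,r_n:A_n$, $\mathrm{dom}(R)=\{r_1,\ldots,r_n\}$; contexts $\Gamma=x_1:A_1,\ldots$. Terms $M ::= x\mid r\mid *\mid \lambda x.M\mid MM\mid \mathsf{get}(M)\mid\mathsf{set}(M,M)$; values $V::= r\mid *\mid \lambda x.M$. A store is a finite collection of bindings $r\Leftarrow v$ with $v$ a set of values ($r\Leftarrow v_1,r\Leftarrow v_2$ identified with $r\Leftarrow v_1\cup v_2$, $r\Leftarrow V$ meaning $r\Leftarrow\{V\}$); $\mathrm{dom}(S)$ is the set of bound regions, $S(r)$ the set of values bound to $r$. A program is a nonempty multiset of terms and stores (comma associative and commutative). Reduction. Evaluation contexts $E ::= [\,]\mid EM\mid VE\mid \mathsf{get}(E)\mid\mathsf{set}(E,M)\mid\mathsf{set}(V,E)$. Rules: $E[(\lambda x.M)V]\to E[[V/x]M]$; $E[\mathsf{get}(r)], r\Leftarrow V\to E[V], r\Leftarrow V$; $E[\mathsf{set}(r,V)]\to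 E[*], r\Leftarrow V$; if $P\to P'$ then $P,P''\to P',P''$. Stratified well-formedness: $\emptyset\vdash$; if $R\vdash A$, $r\notin\mathrm{dom}(R)$ then $R,r:A\vdash$; if $R\vdash$ then $R\vdash\mathbf 1$; if $R\vdash$, $r:A\in R$ then $R\vdash\mathrm{Reg}_rA$; if $R\vdash A$, $R\vdash B$, $e\subseteq\mathrm{dom}(R)$ then $R\vdash A\xrightarrow{e}B$; $R\vdash(A,e)$ iff $R\vdash A$ and $e\subseteq\mathrm{dom}(R)$; $R\vdash\Gamma$ iff $R\vdash$ and $R\vdash A_i$ for each $x_i:A_i\in\Gamma$. Subtyping: if $R\vdash A$ then $R\vdash A\le A$; if $R\vdash A'\le A$, $R\vdash B\le B'$, $e\subseteq e'\subseteq\mathrm{dom}(R)$ then $R\vdash (A\xrightarrow{e}B)\le(A'\xrightarrow{e'}B')$; if $R\vdash A\le A'$, $e\subseteq e'\subseteq\mathrm{dom}(R)$ then $R\vdash(A,e)\le(A',e')$. Typing: if $R\vdash\Gamma$, $x:A\in\Gamma$ then $R;\Gamma\vdash x:(A,\emptyset)$; if $R\vdash\Gamma$, $r:A\in R$ then $R;\Gamma\vdash r:(\mathrm{Reg}_rA,\emptyset)$; if $R\vdash\Gamma$ then $R;\Gamma\vdash *:(\mathbf 1,\emptyset)$; from $R;\Gamma,x:A\vdash M:(B,e)$ infer $R;\Gamma\vdash\lambda x.M:(A\xrightarrow{e}B,\emptyset)$; from $R;\Gamma\vdash M:(A\xrightarrow{e_2}B,e_1)$ and $R;\Gamma\vdash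 N:(A,e_3)$ infer $R;\Gamma\vdash MN:(B,e_1\cup e_2\cup e_3)$; from $R;\Gamma\vdash M:(\mathrm{Reg}_rA,e)$ infer $R;\Gamma\vdash\mathsf{get}(M):(A,e\cup\{r\})$; from $R;\Gamma\vdash M:(\mathrm{Reg}_rA,e_1)$ and $R;\Gamma\vdash N:(A,e_2)$ infer $R;\Gamma\vdash\mathsf{set}(M,N):(\mathbf 1,e_1\cup e_2\cup\{r\})$; from $R;\Gamma\vdash M:(A,e)$ and $R\vdash(A,e)\le(A',e')$ infer $R;\Gamma\vdash M:(A',e')$. With a behaviour type $\mathbf B$: if $r:A\in R$ and $R;\Gamma\vdash V:(A,\emptyset)$ for all $V\in v$ then $R;\Gamma\vdash r\Leftarrow v:(\mathbf B,\emptyset)$; if $R;\Gamma\vdash X_i:(\alpha_i,e_i)$ for $i=1,\ldots,n\ge1$ ($\alpha_i$ a type or $\mathbf B$) then $R;\Gamma\vdash X_1,\ldots,X_n:(\mathbf B,e_1\cup\cdots\cup e_n)$. Interpretation. $SN$ is the set of single-threaded programs $M,S$ all of whose reduction sequences are finite. $(M,S)\Downarrow(N,S')$ means $M,S\to^* N,S'$ and $N,S'$ is irreducible. $R'\ge R$ means $R'\vdash$ and $R'=R,R''$ for some $R''$. For $R=r_1:A_1,\ldots,r_n:A_n$ let $R_{r_i}=r_1:A_1,\ldots,r_{i-1}:A_{i-1}$. Define, by induction on the height of the derivations of $R\vdash$ and $R\vdash(A,e)$: $[\![R]\!]$ is the set of pairs $R'\vdash S$ with $R'\ge R$, $\mathrm{dom}(S)=\mathrm{dom}(R)$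 and $S(r_i)=\{V\mid R'\vdash V\in[\![R_{r_i}\vdash(A_i,\emptyset)]\!]\}$ for each $i$; $[\![R]\!](R')$ denotes the unique such $S$. $[\![R\vdash(A,e)]\!]$ (defined when $R\vdash(A,e)$) is the set of pairs $R'\vdash M$ such that (1) $R'\ge R$ and $R';\emptyset\vdash M:(A,e)$; (2) for all $R''\ge R'$, $M,[\![R]\!](R'')\in SN$; (3) for all $R''\ge R'$ and all $M',S'$, if $(M,[\![R]\!](R''))\Downarrow(M',S')$ then $S'=[\![R]\!](R'')$ and $\mathcal C(A,R,R'',M')$, where $\mathcal C(A,R,R'',M')$ means: if $A=\mathbf 1$ then $M'=*$; if $A=\mathrm{Reg}_rB$ then $M'=r$; if $A=A_1\xrightarrow{e'}A_2$ then $M'=\lambda x.N$ for some $N$ and for all $R_1\ge R''$ and all $V$, $R_1\vdash V\in[\![R\vdash(A_1,\emptyset)]\!]$ implies $R_1\vdash M'V\in[\![R\vdash(A_2,e')]\!]$. -}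

module Defs where

open import Data.Nat using (ℕ; zero; suc; _≟_)
open import Data.Fin using (Fin; zero; suc)
open import Data.Vec using (Vec; []; _∷_; lookup)
open import Data.Vec.Relation.Unary.All using () renaming (All to VAll)
open import Data.List using (List; []; _∷_; _++_; [_])
open import Data.List.Membership.Propositional using (_∈_; _∉_)
open import Data.Product using (Σ; _×_; _,_)
open import Data.Sum using (_⊎_)
open import Data.Empty using (⊥)
open import Data.Bool using (if_then_else_)
open import Relation.Nullary using (¬_)
open import Relation.Nullary.Decidable using (⌊_⌋)
open import Relation.Binary.PropositionalEquality using (_≡_)
open import Relation.Binary.Construct.Closure.ReflexiveTransitive using (Star)
open import Induction.WellFounded using (Acc)
open import Function.Bundles using (_⇔_)

Region : Set
Region = ℕ

-- effects: finite sets of regions, represented by lists (compared as sets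
-- via _⊆_ below)
Effect : Set
Effect = List Region

_⊆_ : Effect → Effect → Set
e ⊆ e' = ∀ {r} → r ∈ e → r ∈ e'

infixr 7 _⟶[_]_
data Ty : Set where
  𝟙      : Ty
  Reg    : Region → Ty → Ty
  _⟶[_]_ : Ty → Effect → Ty → Ty

data Tm (n : ℕ) : Set where
  var  : Fin n → Tm n
  reg  : Region → Tm n
  unit : Tm n
  lam  : Tm (suc n) → Tm n
  app  : Tm n → Tm n → Tm n
  get  : Tm n → Tm n
  set  : Tm n → Tm n → Tm n

data Value {n : ℕ} : Tm n → Set where
  reg  : ∀ r → Value (reg r)
  unit : Value unit
  lam  : ∀ M → Value (lam M)

ext : ∀ {m n} → (Fin m → Fin n) → Fin (suc m) → Fin (suc n)
ext ρ zero    = zero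
ext ρ (suc i) = suc (ρ i)

rename : ∀ {m n} → (Fin m → Fin n) → Tm m → Tm n
rename ρ (var i)   = var (ρ i)
rename ρ (reg r)   = reg r
rename ρ unit      = unit
rename ρ (lam M)   = lam (rename (ext ρ) M)
rename ρ (app M N) = app (rename ρ M) (rename ρ N)
rename ρ (get M)   = get (rename ρ M)
rename ρ (set M N) = set (rename ρ M) (rename ρ N)

exts : ∀ {m n} → (Fin m → Tm n) → Fin (suc m) → Tm (suc n)
exts σ zero    = var zero
exts σ (suc i) = rename suc (σ i)

subst : ∀ {m n} → (Fin m → Tm n) → Tm m → Tm n
subst σ (var i)   = σ i
subst σ (reg r)   = reg r
subst σ unit      = unit
subst σ (lam M)   = lam (subst (exts σ) M)
subst σ (app M N) = app (subst σ M) (subst σ N)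
subst σ (get M)   = get (subst σ M)
subst σ (set M N) = set (subst σ M) (subst σ N)

_⟨_⟩ : ∀ {n} → Tm (suc n) → Tm n → Tm n
M ⟨ V ⟩ = subst σ M
  where
  σ : _
  σ zero    = V
  σ (suc i) = var i

infixl 5 _▸_∶_
data Ctx : Set where
  ε     : Ctx
  _▸_∶_ : Ctx → Region → Ty → Ctx

dom : Ctx → List Region
dom ε           = []
dom (R ▸ r ∶ A) = r ∷ dom R

data _∶_∈ᴿ_ (r : Region) (A : Ty) : Ctx → Set where
  here  : ∀ {R} → r ∶ A ∈ᴿ (R ▸ r ∶ A)
  there : ∀ {R s B} → r ∶ A ∈ᴿ R → r ∶ A ∈ᴿ (R ▸ s ∶ B)

infixl 4 _,,_
_,,_ : Ctx → Ctx → Ctx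
R ,, ε             = R
R ,, (R'' ▸ r ∶ A) = (R ,, R'') ▸ r ∶ A

mutual
  data WFCtx : Ctx → Set where
    wf-ε : WFCtx ε
    wf-▸ : ∀ {R r A} → WFTy R A → r ∉ dom R → WFCtx (R ▸ r ∶ A)

  data WFTy (R : Ctx) : Ty → Set where
    wf-𝟙   : WFCtx R → WFTy R 𝟙
    wf-Reg : ∀ {r A} → WFCtx R → r ∶ A ∈ᴿ R → WFTy R (Reg r A)
    wf-⟶  : ∀ {A B e} → WFTy R A → WFTy R B → e ⊆ dom R → WFTy R (A ⟶[ e ] B)

WFTyE : Ctx → Ty → Effect → Set
WFTyE R A e = WFTy R A × (e ⊆ dom R)

WFEnv : ∀ {n} → Ctx → Vec Ty n → Set
WFEnv R Γ = WFCtx R × VAll (WFTy R) Γ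

data _⊢_≤_ (R : Ctx) : Ty → Ty → Set where
  ≤-refl : ∀ {A} → WFTy R A → R ⊢ A ≤ A
  ≤-⟶   : ∀ {A A' B B' e e'} → R ⊢ A' ≤ A → R ⊢ B ≤ B' →
           e ⊆ e' → e' ⊆ dom R → R ⊢ (A ⟶[ e ] B) ≤ (A' ⟶[ e' ] B')

SubE : Ctx → Ty → Effect → Ty → Effect → Set
SubE R A e A' e' = (R ⊢ A ≤ A') × (e ⊆ e') × (e' ⊆ dom R)

data _⨾_⊢_∶_,_ {n : ℕ} (R : Ctx) (Γ : Vec Ty n) : Tm n → Ty → Effect → Set where
  t-var  : ∀ {i} → WFEnv R Γ → R ⨾ Γ ⊢ var i ∶ lookup Γ i , []
  t-reg  : ∀ {r A} → WFEnv R Γ → r ∶ A ∈ᴿ R → R ⨾ Γ ⊢ reg r ∶ Reg r A , []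
  t-unit : WFEnv R Γ → R ⨾ Γ ⊢ unit ∶ 𝟙 , []
  t-lam  : ∀ {A M B e} → R ⨾ (A ∷ Γ) ⊢ M ∶ B , e → R ⨾ Γ ⊢ lam M ∶ (A ⟶[ e ] B) , []
  t-app  : ∀ {M N A B e₁ e₂ e₃} → R ⨾ Γ ⊢ M ∶ (A ⟶[ e₂ ] B) , e₁ → R ⨾ Γ ⊢ N ∶ A , e₃ →
           R ⨾ Γ ⊢ app M N ∶ B , (e₁ ++ e₂ ++ e₃)
  t-get  : ∀ {M r A e} → R ⨾ Γ ⊢ M ∶ Reg r A , e → R ⨾ Γ ⊢ get M ∶ A , (e ++ [ r ])
  t-set  : ∀ {M N r A e₁ e₂} → R ⨾ Γ ⊢ M ∶ Reg r A , e₁ → R ⨾ Γ ⊢ N ∶ A , e₂ →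
           R ⨾ Γ ⊢ set M N ∶ 𝟙 , (e₁ ++ e₂ ++ [ r ])
  t-sub  : ∀ {M A e A' e'} → R ⨾ Γ ⊢ M ∶ A , e → SubE R A e A' e' → R ⨾ Γ ⊢ M ∶ A' , e'

-- Behaviour typing of a program consisting of closed terms M₁,…,Mₙ (n ≥ 1):
-- R ; ∅ ⊢ M₁,…,Mₙ : (B , e₁ ∪ ⋯ ∪ eₙ)  (nesting of the program rule flattens)
data _⊢ᴮ_,_ (R : Ctx) : List (Tm 0) → Effect → Set where
  one  : ∀ {M A e} → R ⨾ [] ⊢ M ∶ A , e → R ⊢ᴮ (M ∷ []) , e
  cons : ∀ {M Ms A e₁ e₂} → R ⨾ [] ⊢ M ∶ A , e₁ → R ⊢ᴮ Ms , e₂ → R ⊢ᴮ (M ∷ Ms) , (e₁ ++ e₂)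

-- A store is a predicate  S r V  ("r ⇐ V is in S").  During reduction
-- a store only grows (by set), so a configuration is a term together
-- with the list σ of bindings added so far to a fixed initial store S;
-- the current store is  S ⊕ σ.

Store : Set₁
Store = Region → Tm 0 → Set

_⊕_ : Store → List (Region × Tm 0) → Store
(S ⊕ σ) r V = S r V ⊎ (r , V) ∈ σ

emptyStore : Store
emptyStore r V = ⊥

_≐_ : Store → Store → Set
S ≐ S' = ∀ r V → S r V ⇔ S' r V

Conf : Set
Conf = Tm 0 × List (Region × Tm 0)

-- single-threaded reduction  M , S⊕σ → M' , S⊕σ'  (evaluation contexts
-- unfolded into congruence rules)
data Step (S : Store) : Conf → Conf → Set where
  β    : ∀ {M V σ} → Value V → Step S (app (lam M) V , σ) (M ⟨ V ⟩ , σ)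
  getr : ∀ {r V σ} → (S ⊕ σ) r V → Step S (get (reg r) , σ) (V , σ)
  setr : ∀ {r V σ} → Value V → Step S (set (reg r) V , σ) (unit , (r , V) ∷ σ)
  appL : ∀ {M M' N σ σ'} → Step S (M , σ) (M' , σ') → Step S (app M N , σ) (app M' N , σ')
  appR : ∀ {V N N' σ σ'} → Value V → Step S (N , σ) (N' , σ') → Step S (app V N , σ) (app V N' , σ')
  getE : ∀ {M M' σ σ'} → Step S (M , σ) (M' , σ') → Step S (get M , σ) (get M' , σ')
  setL : ∀ {M M' N σ σ'} → Step S (M , σ) (M' , σ') → Step S (set M N , σ) (set M' N , σ')
  setR : ∀ {V N N' σ σ'} → Value V → Step S (N , σ) (N' , σ') → Step S (set V N , σ) (set V N' , σ')

SN : Tm 0 → Store → Set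
SN M S = Acc (λ c c' → Step S c' c) (M , [])

Irreducible : Store → Conf → Set
Irreducible S c = ∀ c' → ¬ Step S c c'

_⇓[_]_ : Tm 0 → Store → Conf → Set
M ⇓[ S ] c = Star (Step S) (M , []) c × Irreducible S c

PConf : Set
PConf = List (Tm 0) × List (Region × Tm 0)

data PStep (S : Store) : PConf → PConf → Set where
  thread : ∀ {Ms Ns M M' σ σ'} → Step S (M , σ) (M' , σ') →
           PStep S (Ms ++ M ∷ Ns , σ) (Ms ++ M' ∷ Ns , σ')

Terminates : List (Tm 0) → Set
Terminates Ms = Acc (λ c c' → PStep emptyStore c' c) (Ms , [])

_≥_ : Ctx → Ctx → Set
R' ≥ R = WFCtx R' × Σ Ctx (λ R'' → R' ≡ (R ,, R''))

mutual
  -- [[R]](R')  as a predicate:  ⟦ R ⟧ᶜ R' r V  iff  V ∈ S(r)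
  ⟦_⟧ᶜ : Ctx → Ctx → Store
  ⟦ ε ⟧ᶜ R' r' V = ⊥
  ⟦ R ▸ r ∶ A ⟧ᶜ R' r' V =
    if ⌊ r' ≟ r ⌋ then (Value V × ⟦ R ⊢ A , [] ⟧ R' V) else ⟦ R ⟧ᶜ R' r' V

  -- ⟦ R ⊢ A , e ⟧ R' M   means   R' ⊢ M ∈ [[R ⊢ (A,e)]]
  ⟦_⊢_,_⟧ : Ctx → Ty → Effect → Ctx → Tm 0 → Set
  ⟦ R ⊢ A , e ⟧ R' M =
      (R' ≥ R)
    × (R' ⨾ [] ⊢ M ∶ A , e)
    × (∀ R'' → R'' ≥ R' → SN M (⟦ R ⟧ᶜ R''))
    × (∀ R'' → R'' ≥ R' → ∀ M' σ → M ⇓[ ⟦ R ⟧ᶜ R'' ] (M' , σ) →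
         ((⟦ R ⟧ᶜ R'' ⊕ σ) ≐ ⟦ R ⟧ᶜ R'') × 𝒞 A R R'' M')

  𝒞 : Ty → Ctx → Ctx → Tm 0 → Set
  𝒞 𝟙 R R'' M' = M' ≡ unit
  𝒞 (Reg r B) R R'' M' = M' ≡ reg r
  𝒞 (A₁ ⟶[ e' ] A₂) R R'' M' =
    Σ (Tm 1) λ N → (M' ≡ lam N) ×
      (∀ R₁ → R₁ ≥ R'' → ∀ V → Value V → ⟦ R ⊢ A₁ , [] ⟧ R₁ V →
         ⟦ R ⊢ A₂ , e' ⟧ R₁ (app M' V))

module Submission where

-- Part (1).  "Related ⇒ typable" is built into the relation; the converse is
-- the fundamental lemma, by induction on typing with one compatibility lemma
-- per rule.  It rests on
--  * syntactic metatheory: weakening, substitution, and subject reduction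
--    refined by effect locality (a step reads and writes only regions of its
--    effect, and can be replayed over any store agreeing on them);
--  * evaluation over a fixed store (Eval): invariance under store inclusion,
--    and the bind lemma for evaluation frames;
--  * the store interpretation: by locality ⟦ R₀ ⊢ A , e ⟧ = ⟦ R ⊢ A , e ⟧ for
--    R ≥ R₀, so the store ⟦ R ⟧ᶜ can be read and written through the relation
--    at R; canonical values make it non-empty, so reads never get stuck.
-- Part (2).  A well-typed program only writes values already present in the
-- interpreted store S, so its threads are simulated by independent reductions
-- over S, each terminating by (1); interleavings of terminating threads
-- terminate.


open import Defs
open import Data.Nat using (suc; _≟_)
open import Data.Fin using (Fin; zero; suc)
open import Data.Vec using (Vec; []; _∷_; lookup)
open import Data.Vec.Relation.Unary.All using ([]; _∷_) renaming (map to vmap)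
open import Data.Vec.Relation.Unary.All.Properties using () renaming (lookup⁺ to vlookup)
open import Data.List using (List; []; _∷_; _++_; [_])
open import Data.List.Properties using (++-assoc)
open import Data.List.Relation.Unary.All using (All) renaming ([] to A[]; _∷_ to _A∷_)
open import Data.List.Membership.Propositional using (_∈_; _∉_)
open import Data.List.Membership.Propositional.Properties using (∈-++⁺ˡ; ∈-++⁺ʳ; ∈-++⁻)
open import Data.List.Relation.Unary.Any using (here; there)
open import Data.Product using (Σ; _×_; _,_; proj₁; proj₂)
open import Data.Sum using (_⊎_; inj₁; inj₂)
open import Data.Empty using (⊥-elim)
open import Relation.Nullary using (¬_; yes; no)
open import Relation.Binary.PropositionalEquality
  using (_≡_; _≗_; refl; sym; trans; cong; cong₂) renaming (subst to ≡subst)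
open import Relation.Binary.Construct.Closure.ReflexiveTransitive using (Star; ε; _◅_)
open import Induction.WellFounded using (Acc; acc)
open import Function.Bundles using (_⇔_; mk⇔; Equivalence)
open import Function.Construct.Composition using (_⇔-∘_)
open import Function.Construct.Symmetry using (⇔-sym)
open import Function using (_∘_; id)

open Equivalence using (to; from)

,,-assoc : ∀ R X Y → ((R ,, X) ,, Y) ≡ (R ,, (X ,, Y))
,,-assoc R X ε = refl
,,-assoc R X (Y ▸ r ∶ A) = cong (λ Z → Z ▸ r ∶ A) (,,-assoc R X Y)

∈ᴿ⇒dom : ∀ {r A R} → r ∶ A ∈ᴿ R → r ∈ dom R
∈ᴿ⇒dom here = here refl
∈ᴿ⇒dom (there m) = there (∈ᴿ⇒dom m)

WFTy⇒WFCtx : ∀ {R A} → WFTy R A → WFCtx R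
WFTy⇒WFCtx (wf-𝟙 w) = w
WFTy⇒WFCtx (wf-Reg w _) = w
WFTy⇒WFCtx (wf-⟶ a _ _) = WFTy⇒WFCtx a

≥-refl : ∀ {R} → WFCtx R → R ≥ R
≥-refl w = w , ε , refl

≥-trans : ∀ {R₂ R₁ R} → R₂ ≥ R₁ → R₁ ≥ R → R₂ ≥ R
≥-trans {R = R} (w , X , refl) (_ , Y , refl) = w , (Y ,, X) , ,,-assoc R Y X

≥⇒WFCtx : ∀ {R' R} → R' ≥ R → WFCtx R
≥⇒WFCtx (w , X , refl) = strip X w
  where
  strip : ∀ {R} X → WFCtx (R ,, X) → WFCtx R
  strip ε w = w
  strip (X ▸ _ ∶ _) (wf-▸ a _) = strip X (WFTy⇒WFCtx a)

∈ᴿ-≥ : ∀ {r A R R'} → R' ≥ R → r ∶ A ∈ᴿ R → r ∶ A ∈ᴿ R'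
∈ᴿ-≥ (_ , X , refl) = wk X
  where
  wk : ∀ {r A R} X → r ∶ A ∈ᴿ R → r ∶ A ∈ᴿ (R ,, X)
  wk ε m = m
  wk (X ▸ _ ∶ _) m = there (wk X m)

dom-wk : ∀ {r R} X → r ∈ dom R → r ∈ dom (R ,, X)
dom-wk ε m = m
dom-wk (X ▸ _ ∶ _) m = there (dom-wk X m)

⊆dom-≥ : ∀ {R R' e} → R' ≥ R → e ⊆ dom R → e ⊆ dom R'
⊆dom-≥ (_ , X , refl) s m = dom-wk X (s m)

WFTy-≥ : ∀ {R R' A} → R' ≥ R → WFTy R A → WFTy R' A
WFTy-≥ g (wf-𝟙 _) = wf-𝟙 (proj₁ g)
WFTy-≥ g (wf-Reg _ m) = wf-Reg (proj₁ g) (∈ᴿ-≥ g m)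
WFTy-≥ g (wf-⟶ a b s) = wf-⟶ (WFTy-≥ g a) (WFTy-≥ g b) (⊆dom-≥ g s)

∈ᴿ-WF : ∀ {R r A} → WFCtx R → r ∶ A ∈ᴿ R → WFTy R A
∈ᴿ-WF w@(wf-▸ a _) here = WFTy-≥ (w , _ , refl) a
∈ᴿ-WF w@(wf-▸ a _) (there m) = WFTy-≥ (w , _ , refl) (∈ᴿ-WF (WFTy⇒WFCtx a) m)

∈ᴿ-unique : ∀ {R r A B} → WFCtx R → r ∶ A ∈ᴿ R → r ∶ B ∈ᴿ R → A ≡ B
∈ᴿ-unique w here here = refl
∈ᴿ-unique (wf-▸ _ f) here (there m) = ⊥-elim (f (∈ᴿ⇒dom m))
∈ᴿ-unique (wf-▸ _ f) (there m) here = ⊥-elim (f (∈ᴿ⇒dom m))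
∈ᴿ-unique (wf-▸ a _) (there m) (there n) = ∈ᴿ-unique (WFTy⇒WFCtx a) m n

≤-WFˡ : ∀ {R A B} → R ⊢ A ≤ B → WFTy R A
≤-WFʳ : ∀ {R A B} → R ⊢ A ≤ B → WFTy R B
≤-WFˡ (≤-refl a) = a
≤-WFˡ (≤-⟶ a b s d) = wf-⟶ (≤-WFʳ a) (≤-WFˡ b) (d ∘ s)
≤-WFʳ (≤-refl a) = a
≤-WFʳ (≤-⟶ a b s d) = wf-⟶ (≤-WFˡ a) (≤-WFʳ b) d

≤-trans : ∀ {R A B C} → R ⊢ A ≤ B → R ⊢ B ≤ C → R ⊢ A ≤ C
≤-trans (≤-refl _) q = q
≤-trans p@(≤-⟶ _ _ _ _) (≤-refl _) = p
≤-trans (≤-⟶ a b s d) (≤-⟶ a' b' s' d') = ≤-⟶ (≤-trans a' a) (≤-trans b b') (s' ∘ s) d'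

≤-≥ : ∀ {R R' A B} → R' ≥ R → R ⊢ A ≤ B → R' ⊢ A ≤ B
≤-≥ g (≤-refl a) = ≤-refl (WFTy-≥ g a)
≤-≥ g (≤-⟶ a b s d) = ≤-⟶ (≤-≥ g a) (≤-≥ g b) s (⊆dom-≥ g d)

≤-inv⟶ : ∀ {R A B e C} → R ⊢ (A ⟶[ e ] B) ≤ C →
  Σ Ty λ A' → Σ Ty λ B' → Σ Effect λ e' →
    (C ≡ (A' ⟶[ e' ] B')) × R ⊢ A' ≤ A × R ⊢ B ≤ B' × e ⊆ e'
≤-inv⟶ (≤-refl (wf-⟶ a b d)) = _ , _ , _ , refl , ≤-refl a , ≤-refl b , id
≤-inv⟶ (≤-⟶ a b s d) = _ , _ , _ , refl , a , b , s

≤-invReg : ∀ {R r A C} → R ⊢ Reg r A ≤ C → C ≡ Reg r A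
≤-invReg (≤-refl _) = refl

⊆-++ˡ : ∀ {e₁} e₂ → e₁ ⊆ (e₁ ++ e₂)
⊆-++ˡ e₂ m = ∈-++⁺ˡ m

⊆-++ʳ : ∀ e₁ {e₂} → e₂ ⊆ (e₁ ++ e₂)
⊆-++ʳ e₁ m = ∈-++⁺ʳ e₁ m

⊆-++ : ∀ {e₁ e₂ e} → e₁ ⊆ e → e₂ ⊆ e → (e₁ ++ e₂) ⊆ e
⊆-++ {e₁} s t m with ∈-++⁻ e₁ m
... | inj₁ x = s x
... | inj₂ y = t y

⊆-[] : ∀ {e} → [] ⊆ e
⊆-[] ()

ext-cong : ∀ {m n} {ρ ρ' : Fin m → Fin n} → ρ ≗ ρ' → ext ρ ≗ ext ρ'
ext-cong h zero = refl
ext-cong h (suc i) = cong suc (h i)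

rename-cong : ∀ {m n} {ρ ρ' : Fin m → Fin n} → ρ ≗ ρ' → ∀ M → rename ρ M ≡ rename ρ' M
rename-cong h (var i) = cong var (h i)
rename-cong h (reg r) = refl
rename-cong h unit = refl
rename-cong h (lam M) = cong lam (rename-cong (ext-cong h) M)
rename-cong h (app M N) = cong₂ app (rename-cong h M) (rename-cong h N)
rename-cong h (get M) = cong get (rename-cong h M)
rename-cong h (set M N) = cong₂ set (rename-cong h M) (rename-cong h N)

exts-cong : ∀ {m n} {σ τ : Fin m → Tm n} → σ ≗ τ → exts σ ≗ exts τ
exts-cong h zero = refl
exts-cong h (suc i) = cong (rename suc) (h i)

subst-cong : ∀ {m n} {σ τ : Fin m → Tm n} → σ ≗ τ → ∀ M → subst σ M ≡ subst τ M
subst-cong h (var i) = h i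
subst-cong h (reg r) = refl
subst-cong h unit = refl
subst-cong h (lam M) = cong lam (subst-cong (exts-cong h) M)
subst-cong h (app M N) = cong₂ app (subst-cong h M) (subst-cong h N)
subst-cong h (get M) = cong get (subst-cong h M)
subst-cong h (set M N) = cong₂ set (subst-cong h M) (subst-cong h N)

rename-rename : ∀ {l m n} (ρ' : Fin m → Fin n) (ρ : Fin l → Fin m) M →
  rename ρ' (rename ρ M) ≡ rename (ρ' ∘ ρ) M
rename-rename ρ' ρ (var i) = refl
rename-rename ρ' ρ (reg r) = refl
rename-rename ρ' ρ unit = refl
rename-rename ρ' ρ (lam M) = cong lam (trans (rename-rename (ext ρ') (ext ρ) M)
  (rename-cong (λ { zero → refl ; (suc i) → refl }) M))
rename-rename ρ' ρ (app M N) = cong₂ app (rename-rename ρ' ρ M) (rename-rename ρ' ρ N)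
rename-rename ρ' ρ (get M) = cong get (rename-rename ρ' ρ M)
rename-rename ρ' ρ (set M N) = cong₂ set (rename-rename ρ' ρ M) (rename-rename ρ' ρ N)

subst-rename : ∀ {l m n} (τ : Fin m → Tm n) (ρ : Fin l → Fin m) M →
  subst τ (rename ρ M) ≡ subst (τ ∘ ρ) M
subst-rename τ ρ (var i) = refl
subst-rename τ ρ (reg r) = refl
subst-rename τ ρ unit = refl
subst-rename τ ρ (lam M) = cong lam (trans (subst-rename (exts τ) (ext ρ) M)
  (subst-cong (λ { zero → refl ; (suc i) → refl }) M))
subst-rename τ ρ (app M N) = cong₂ app (subst-rename τ ρ M) (subst-rename τ ρ N)
subst-rename τ ρ (get M) = cong get (subst-rename τ ρ M)
subst-rename τ ρ (set M N) = cong₂ set (subst-rename τ ρ M) (subst-rename τ ρ N)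

rename-subst : ∀ {l m n} (ρ : Fin m → Fin n) (τ : Fin l → Tm m) M →
  rename ρ (subst τ M) ≡ subst (rename ρ ∘ τ) M
rename-subst ρ τ (var i) = refl
rename-subst ρ τ (reg r) = refl
rename-subst ρ τ unit = refl
rename-subst ρ τ (lam M) = cong lam (trans (rename-subst (ext ρ) (exts τ) M)
  (subst-cong (λ { zero → refl ; (suc i) → trans (rename-rename (ext ρ) suc (τ i))
                                           (sym (rename-rename suc ρ (τ i))) }) M))
rename-subst ρ τ (app M N) = cong₂ app (rename-subst ρ τ M) (rename-subst ρ τ N)
rename-subst ρ τ (get M) = cong get (rename-subst ρ τ M)
rename-subst ρ τ (set M N) = cong₂ set (rename-subst ρ τ M) (rename-subst ρ τ N)

subst-subst : ∀ {l m n} (τ : Fin m → Tm n) (σ : Fin l → Tm m) M →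
  subst τ (subst σ M) ≡ subst (subst τ ∘ σ) M
subst-subst τ σ (var i) = refl
subst-subst τ σ (reg r) = refl
subst-subst τ σ unit = refl
subst-subst τ σ (lam M) = cong lam (trans (subst-subst (exts τ) (exts σ) M)
  (subst-cong (λ { zero → refl ; (suc i) → trans (subst-rename (exts τ) suc (σ i))
                                           (sym (rename-subst suc τ (σ i))) }) M))
subst-subst τ σ (app M N) = cong₂ app (subst-subst τ σ M) (subst-subst τ σ N)
subst-subst τ σ (get M) = cong get (subst-subst τ σ M)
subst-subst τ σ (set M N) = cong₂ set (subst-subst τ σ M) (subst-subst τ σ N)

subst-id : ∀ {n} {σ : Fin n → Tm n} → σ ≗ var → ∀ M → subst σ M ≡ M
subst-id h (var i) = h i
subst-id h (reg r) = refl
subst-id h unit = refl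
subst-id h (lam M) = cong lam (subst-id (λ { zero → refl ; (suc i) → cong (rename suc) (h i) }) M)
subst-id h (app M N) = cong₂ app (subst-id h M) (subst-id h N)
subst-id h (get M) = cong get (subst-id h M)
subst-id h (set M N) = cong₂ set (subst-id h M) (subst-id h N)

subst-closed : ∀ (σ : Fin 0 → Tm 0) M → subst σ M ≡ M
subst-closed σ M = subst-id (λ ()) M

_•_ : ∀ {n} → Tm 0 → (Fin n → Tm 0) → Fin (suc n) → Tm 0
(V • γ) zero = V
(V • γ) (suc i) = γ i

subst-β : ∀ {n} (γ : Fin n → Tm 0) (P : Tm (suc n)) (V : Tm 0) →
  (subst (exts γ) P) ⟨ V ⟩ ≡ subst (V • γ) P
subst-β γ P V =
  trans (subst-subst _ (exts γ) P)
        (subst-cong (λ { zero → refl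
                       ; (suc i) → trans (subst-rename _ suc (γ i)) (subst-closed _ (γ i)) }) P)

⊢⇒WFEnv : ∀ {n R Γ M A e} → _⨾_⊢_∶_,_ {n} R Γ M A e → WFEnv R Γ
⊢⇒WFEnv (t-var w) = w
⊢⇒WFEnv (t-reg w _) = w
⊢⇒WFEnv (t-unit w) = w
⊢⇒WFEnv (t-lam t) with ⊢⇒WFEnv t
... | w , (_ ∷ ws) = w , ws
⊢⇒WFEnv (t-app t _) = ⊢⇒WFEnv t
⊢⇒WFEnv (t-get t) = ⊢⇒WFEnv t
⊢⇒WFEnv (t-set t _) = ⊢⇒WFEnv t
⊢⇒WFEnv (t-sub t _) = ⊢⇒WFEnv t

⊢⇒WFCtx : ∀ {n R Γ M A e} → _⨾_⊢_∶_,_ {n} R Γ M A e → WFCtx R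
⊢⇒WFCtx t = proj₁ (⊢⇒WFEnv t)

⊢⇒WFTyE : ∀ {n R Γ M A e} → _⨾_⊢_∶_,_ {n} R Γ M A e → WFTyE R A e
⊢⇒WFTyE (t-var (w , ws)) = vlookup ws _ , ⊆-[]
⊢⇒WFTyE (t-reg (w , _) m) = wf-Reg w m , ⊆-[]
⊢⇒WFTyE (t-unit (w , _)) = wf-𝟙 w , ⊆-[]
⊢⇒WFTyE (t-lam t) with ⊢⇒WFEnv t | ⊢⇒WFTyE t
... | _ , (a ∷ _) | b , s = wf-⟶ a b s , ⊆-[]
⊢⇒WFTyE (t-app t u) with ⊢⇒WFTyE t | ⊢⇒WFTyE u
... | wf-⟶ _ b s₂ , s₁ | _ , s₃ = b , ⊆-++ s₁ (⊆-++ s₂ s₃)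
⊢⇒WFTyE (t-get t) with ⊢⇒WFTyE t
... | wf-Reg w m , s = ∈ᴿ-WF w m , ⊆-++ s (λ { (here refl) → ∈ᴿ⇒dom m })
⊢⇒WFTyE (t-set t u) with ⊢⇒WFTyE t | ⊢⇒WFTyE u
... | wf-Reg w m , s | _ , s' = wf-𝟙 w , ⊆-++ s (⊆-++ s' (λ { (here refl) → ∈ᴿ⇒dom m }))
⊢⇒WFTyE (t-sub t (le , _ , d)) = ≤-WFʳ le , d

⊢Reg⇒∈ᴿ : ∀ {n R Γ M r A e} → _⨾_⊢_∶_,_ {n} R Γ M (Reg r A) e → r ∶ A ∈ᴿ R
⊢Reg⇒∈ᴿ t with ⊢⇒WFTyE t
... | wf-Reg _ m , _ = m

⊢-≥ : ∀ {n R R' Γ M A e} → R' ≥ R → _⨾_⊢_∶_,_ {n} R Γ M A e → R' ⨾ Γ ⊢ M ∶ A , e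
⊢-≥ {R' = R'} g = go
  where
  env : ∀ {n} {Γ : Vec Ty n} → WFEnv _ Γ → WFEnv R' Γ
  env (_ , ws) = proj₁ g , vmap (WFTy-≥ g) ws
  go : ∀ {n Γ M A e} → _⨾_⊢_∶_,_ {n} _ Γ M A e → R' ⨾ Γ ⊢ M ∶ A , e
  go (t-var ws) = t-var (env ws)
  go (t-reg ws m) = t-reg (env ws) (∈ᴿ-≥ g m)
  go (t-unit ws) = t-unit (env ws)
  go (t-lam t) = t-lam (go t)
  go (t-app t u) = t-app (go t) (go u)
  go (t-get t) = t-get (go t)
  go (t-set t u) = t-set (go t) (go u)
  go (t-sub t (le , s , d)) = t-sub (go t) (≤-≥ g le , s , ⊆dom-≥ g d)

⊢-rename : ∀ {m n R} {Γ : Vec Ty m} {Δ : Vec Ty n} {ρ : Fin m → Fin n} →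
  (∀ i → lookup Δ (ρ i) ≡ lookup Γ i) → WFEnv R Δ →
  ∀ {M A e} → R ⨾ Γ ⊢ M ∶ A , e → R ⨾ Δ ⊢ rename ρ M ∶ A , e
⊢-rename {ρ = ρ} h wΔ (t-var {i = i} _) = ≡subst (λ B → _ ⨾ _ ⊢ var (ρ i) ∶ B , []) (h i) (t-var wΔ)
⊢-rename h wΔ (t-reg _ m) = t-reg wΔ m
⊢-rename h wΔ (t-unit _) = t-unit wΔ
⊢-rename h wΔ (t-lam t) with ⊢⇒WFEnv t
... | _ , (a ∷ _) = t-lam (⊢-rename (λ { zero → refl ; (suc i) → h i }) (proj₁ wΔ , (a ∷ proj₂ wΔ)) t)
⊢-rename h wΔ (t-app t u) = t-app (⊢-rename h wΔ t) (⊢-rename h wΔ u)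
⊢-rename h wΔ (t-get t) = t-get (⊢-rename h wΔ t)
⊢-rename h wΔ (t-set t u) = t-set (⊢-rename h wΔ t) (⊢-rename h wΔ u)
⊢-rename h wΔ (t-sub t s) = t-sub (⊢-rename h wΔ t) s

⊢-subst : ∀ {m n R} {Γ : Vec Ty m} {Δ : Vec Ty n} {σ : Fin m → Tm n} →
  (∀ i → R ⨾ Δ ⊢ σ i ∶ lookup Γ i , []) → WFEnv R Δ →
  ∀ {M A e} → R ⨾ Γ ⊢ M ∶ A , e → R ⨾ Δ ⊢ subst σ M ∶ A , e
⊢-subst h wΔ (t-var {i = i} _) = h i
⊢-subst h wΔ (t-reg _ m) = t-reg wΔ m
⊢-subst h wΔ (t-unit _) = t-unit wΔ
⊢-subst {σ = σ} h wΔ (t-lam t) with ⊢⇒WFEnv t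
... | _ , (a ∷ _) = t-lam (⊢-subst h' wΔ' t)
  where
  wΔ' = proj₁ wΔ , (a ∷ proj₂ wΔ)
  h' : ∀ i → _ ⨾ _ ⊢ exts σ i ∶ _ , []
  h' zero = t-var wΔ'
  h' (suc i) = ⊢-rename (λ _ → refl) wΔ' (h i)
⊢-subst h wΔ (t-app t u) = t-app (⊢-subst h wΔ t) (⊢-subst h wΔ u)
⊢-subst h wΔ (t-get t) = t-get (⊢-subst h wΔ t)
⊢-subst h wΔ (t-set t u) = t-set (⊢-subst h wΔ t) (⊢-subst h wΔ u)
⊢-subst h wΔ (t-sub t s) = t-sub (⊢-subst h wΔ t) s

⊢-instantiate : ∀ {R A B e P V} → R ⨾ (A ∷ []) ⊢ P ∶ B , e → R ⨾ [] ⊢ V ∶ A , [] →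
  R ⨾ [] ⊢ P ⟨ V ⟩ ∶ B , e
⊢-instantiate t tV = ⊢-subst (λ { zero → tV ; (suc ()) }) (⊢⇒WFCtx tV , []) t

⊢-value : ∀ {n R Γ V A e} → Value V → _⨾_⊢_∶_,_ {n} R Γ V A e → R ⨾ Γ ⊢ V ∶ A , []
⊢-value v (t-var w) = t-var w
⊢-value v (t-reg w m) = t-reg w m
⊢-value v (t-unit w) = t-unit w
⊢-value v (t-lam t) = t-lam t
⊢-value v (t-sub t (le , s , d)) = t-sub (⊢-value v t) (le , ⊆-[] , ⊆-[])

lam-inversion : ∀ {n R Γ P C e} → _⨾_⊢_∶_,_ {n} R Γ (lam P) C e →
  Σ Ty λ A₀ → Σ Ty λ B₀ → Σ Effect λ e₀ →
    (R ⨾ (A₀ ∷ Γ) ⊢ P ∶ B₀ , e₀) × R ⊢ (A₀ ⟶[ e₀ ] B₀) ≤ C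
lam-inversion (t-lam t) = _ , _ , _ , t , ≤-refl (proj₁ (⊢⇒WFTyE (t-lam t)))
lam-inversion (t-sub t (le , _)) with lam-inversion t
... | A₀ , B₀ , e₀ , t' , le' = A₀ , B₀ , e₀ , t' , ≤-trans le' le

reg-inversion : ∀ {n R Γ r C e} → _⨾_⊢_∶_,_ {n} R Γ (reg r) C e →
  Σ Ty λ A → r ∶ A ∈ᴿ R × C ≡ Reg r A
reg-inversion (t-reg w m) = _ , m , refl
reg-inversion (t-sub t (le , _)) with reg-inversion t
... | A , m , refl = A , m , ≤-invReg le

-- Subject reduction with effect locality
--
-- A step of a well-typed term preserves its type and effect, only writes
-- well-typed values into regions of its effect, and only depends on the
-- initial store through the regions of its effect.

StoreOK : Ctx → Store → Set
StoreOK R T = ∀ r V → T r V → Value V × Σ Ty (λ A → r ∶ A ∈ᴿ R × R ⨾ [] ⊢ V ∶ A , [])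

Writes : Ctx → Effect → List (Region × Tm 0) → Set
Writes R e δ = ∀ r V → (r , V) ∈ δ → r ∈ e × Value V × Σ Ty (λ A → r ∶ A ∈ᴿ R × R ⨾ [] ⊢ V ∶ A , [])

writes-[] : ∀ {R e} → Writes R e []
writes-[] r V ()

writes-⊆ : ∀ {R e e' δ} → e ⊆ e' → Writes R e δ → Writes R e' δ
writes-⊆ s d r V m with d r V m
... | x , y = s x , y

writes-++ : ∀ {R e δ σ} → Writes R e δ → Writes R e σ → Writes R e (δ ++ σ)
writes-++ {δ = δ} d d' r V m with ∈-++⁻ δ m
... | inj₁ x = d r V x
... | inj₂ y = d' r V y

storeOK-⊕ : ∀ {R e T δ} → StoreOK R T → Writes R e δ → StoreOK R (T ⊕ δ)
storeOK-⊕ st d r V (inj₁ x) = st r V x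
storeOK-⊕ st d r V (inj₂ y) = proj₂ (d r V y)

storeOK-++ : ∀ {R e T σ δ} → StoreOK R (T ⊕ σ) → Writes R e δ → StoreOK R (T ⊕ (δ ++ σ))
storeOK-++ st d r V (inj₁ x) = st r V (inj₁ x)
storeOK-++ {δ = δ} st d r V (inj₂ y) with ∈-++⁻ δ y
... | inj₁ m = proj₂ (d r V m)
... | inj₂ m = st r V (inj₂ m)

AgreeOn : Effect → Store → Store → Set
AgreeOn e T T' = ∀ r V → r ∈ e → T r V → T' r V

agree-⊆ : ∀ {e e' T T'} → e ⊆ e' → AgreeOn e' T T' → AgreeOn e T T'
agree-⊆ s a r V m x = a r V (s m) x

record Reduct (R : Ctx) (T : Store) (A : Ty) (e : Effect)
              (M M' : Tm 0) (σ σ' : List (Region × Tm 0)) : Set₁ where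
  constructor reduct
  field
    typed   : R ⨾ [] ⊢ M' ∶ A , e
    written : List (Region × Tm 0)
    grows   : σ' ≡ written ++ σ
    writes  : Writes R e written
    local   : ∀ T' → AgreeOn e T T' → Step T' (M , σ) (M' , σ')

reduct-cong : ∀ {R T A e A' e' M M' N N' σ σ'} → e ⊆ e' →
  (R ⨾ [] ⊢ M' ∶ A , e → R ⨾ [] ⊢ N' ∶ A' , e') →
  (∀ {T'} → Step T' (M , σ) (M' , σ') → Step T' (N , σ) (N' , σ')) →
  Reduct R T A e M M' σ σ' → Reduct R T A' e' N N' σ σ'
reduct-cong s retype restep (reduct t δ eq d loc) =
  reduct (retype t) δ eq (writes-⊆ s d) (λ T' ag → restep (loc T' (agree-⊆ s ag)))

β-preservation : ∀ {R P V A B e₁ e₂ e₃} → Value V →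
  R ⨾ [] ⊢ lam P ∶ (A ⟶[ e₂ ] B) , e₁ → R ⨾ [] ⊢ V ∶ A , e₃ →
  R ⨾ [] ⊢ P ⟨ V ⟩ ∶ B , (e₁ ++ e₂ ++ e₃)
β-preservation {e₁ = e₁} {e₃ = e₃} v t u with lam-inversion t
... | _ , _ , _ , tP , le with ≤-inv⟶ le
... | _ , _ , _ , refl , a , b , s =
  t-sub (⊢-instantiate tP (t-sub (⊢-value v u) (a , ⊆-[] , ⊆-[])))
        (b , (λ m → ⊆-++ʳ e₁ (⊆-++ˡ e₃ (s m))) , proj₂ (⊢⇒WFTyE (t-app t u)))

subject-reduction : ∀ {R T A e M M' σ σ'} → WFCtx R → R ⨾ [] ⊢ M ∶ A , e →
  StoreOK R (T ⊕ σ) → Step T (M , σ) (M' , σ') → Reduct R T A e M M' σ σ'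
subject-reduction w (t-app t u) st (β v) = reduct (β-preservation v t u) [] refl writes-[] (λ _ _ → β v)
subject-reduction {T = T} {σ = σ} w tt@(t-get {e = e₀} t) st (getr {r} {V} m)
  with reg-inversion t
... | _ , mem , refl with st r V m
... | _ , _ , mem₁ , tV with ∈ᴿ-unique w mem mem₁
... | refl = reduct (t-sub tV (≤-refl (proj₁ (⊢⇒WFTyE tt)) , ⊆-[] , proj₂ (⊢⇒WFTyE tt)))
                    [] refl writes-[] (λ T' ag → getr (reread T' ag m))
  where
  -- only the read region r, which belongs to the effect, is consulted
  reread : ∀ T' → AgreeOn (e₀ ++ [ r ]) T T' → (T ⊕ σ) r V → (T' ⊕ σ) r V
  reread T' ag (inj₁ x) = inj₁ (ag r V (⊆-++ʳ e₀ (here refl)) x)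
  reread T' ag (inj₂ y) = inj₂ y
subject-reduction w tt@(t-set {e₁ = e₁} {e₂} t u) st (setr {r} {V} v) with reg-inversion t
... | A , mem , refl =
  reduct (t-sub (t-unit (⊢⇒WFEnv tt)) (≤-refl (wf-𝟙 w) , ⊆-[] , proj₂ (⊢⇒WFTyE tt)))
         ((r , V) ∷ []) refl
         (λ { _ _ (here refl) → ⊆-++ʳ e₁ (⊆-++ʳ e₂ (here refl)) , v , A , mem , ⊢-value v u })
         (λ _ _ → setr v)
subject-reduction w (t-app t u) st (appL s) =
  reduct-cong (⊆-++ˡ _) (λ t' → t-app t' u) appL (subject-reduction w t st s)
subject-reduction w (t-app {e₁ = e₁} {e₂} t u) st (appR v s) =
  reduct-cong (⊆-++ʳ e₁ ∘ ⊆-++ʳ e₂) (t-app t) (appR v) (subject-reduction w u st s)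
subject-reduction w (t-get t) st (getE s) =
  reduct-cong (⊆-++ˡ _) t-get getE (subject-reduction w t st s)
subject-reduction w (t-set t u) st (setL s) =
  reduct-cong (⊆-++ˡ _) (λ t' → t-set t' u) setL (subject-reduction w t st s)
subject-reduction w (t-set {e₁ = e₁} t u) st (setR v s) =
  reduct-cong (⊆-++ʳ e₁ ∘ ⊆-++ˡ _) (t-set t) (setR v) (subject-reduction w u st s)
subject-reduction w (t-sub t (le , s , d)) st stp =
  reduct-cong s (λ t' → t-sub t' (le , s , d)) id (subject-reduction w t st stp)

subject-reduction* : ∀ {R T A e M M' σ σ'} → WFCtx R → R ⨾ [] ⊢ M ∶ A , e →
  StoreOK R (T ⊕ σ) → Star (Step T) (M , σ) (M' , σ') → R ⨾ [] ⊢ M' ∶ A , e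
subject-reduction* w t st ε = t
subject-reduction* w t st (_◅_ {j = _ , _} s ss) with subject-reduction w t st s
... | reduct t' δ refl d _ = subject-reduction* w t' (storeOK-++ st d) ss

-- Evaluation over a fixed initial store

Rd : Store → Conf → Conf → Set
Rd S c c' = Step S c' c

Eval : Store → Conf → (Tm 0 → Set) → Set
Eval S c Q = Acc (Rd S) c ×
  (∀ M' σ' → Star (Step S) c (M' , σ') → Irreducible S (M' , σ') → ((S ⊕ σ') ≐ S) × Q M')

value-irreducible : ∀ {S V σ} → Value V → Irreducible S (V , σ)
value-irreducible (reg r) c ()
value-irreducible unit c ()
value-irreducible (lam M) c ()

value? : (M : Tm 0) → Value M ⊎ ¬ Value M
value? (var ())
value? (reg r) = inj₁ (reg r)
value? unit = inj₁ unit
value? (lam M) = inj₁ (lam M)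
value? (app M N) = inj₂ (λ ())
value? (get M) = inj₂ (λ ())
value? (set M N) = inj₂ (λ ())

eval-value : ∀ {S V σ Q} → Value V → Q V → (S ⊕ σ) ≐ S → Eval S (V , σ) Q
eval-value v q eq = acc (λ s → ⊥-elim (value-irreducible v _ s)) ,
  λ { M' σ' ε irr → eq , q ; M' σ' (s ◅ _) irr → ⊥-elim (value-irreducible v _ s) }

eval-expand : ∀ {S c Q} → (∀ {c'} → Step S c c' → Eval S c' Q) →
  (Σ Conf λ c' → Step S c c') → Eval S c Q
eval-expand h (c₀ , s₀) = acc (λ s → proj₁ (h s)) ,
  λ { M' σ' ε irr → ⊥-elim (irr c₀ s₀) ; M' σ' (s ◅ ss) irr → proj₂ (h s) M' σ' ss irr }

eval-map : ∀ {S c} {Q Q' : Tm 0 → Set} → (∀ {M} → Q M → Q' M) → Eval S c Q → Eval S c Q'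
eval-map f (a , P) = a , λ M' σ' ss irr → proj₁ (P M' σ' ss irr) , f (proj₂ (P M' σ' ss irr))

eval-β : ∀ {S P V σ Q} → Value V → Eval S (P ⟨ V ⟩ , σ) Q → Eval S (app (lam P) V , σ) Q
eval-β {S} {P} {V} {σ} {Q} v ev = eval-expand successor (_ , β v)
  where
  successor : ∀ {c'} → Step S (app (lam P) V , σ) c' → Eval S c' Q
  successor (β _) = ev
  successor (appL ())
  successor (appR _ s) = ⊥-elim (value-irreducible v _ s)

-- Simulation: reduction only reads the store, so it can be replayed over
-- any larger store, adding the same bindings.

Included : Store → Store → Set
Included T T' = ∀ r V → T r V → T' r V

included-++ : ∀ {S σ S' τ} δ → Included (S ⊕ σ) (S' ⊕ τ) →
  Included (S ⊕ (δ ++ σ)) (S' ⊕ (δ ++ τ))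
included-++ δ i r V (inj₁ x) with i r V (inj₁ x)
... | inj₁ y = inj₁ y
... | inj₂ y = inj₂ (∈-++⁺ʳ δ y)
included-++ δ i r V (inj₂ y) with ∈-++⁻ δ y
... | inj₁ m = inj₂ (∈-++⁺ˡ m)
... | inj₂ m with i r V (inj₂ m)
... | inj₁ z = inj₁ z
... | inj₂ z = inj₂ (∈-++⁺ʳ δ z)

simulate : ∀ {S S' M M' σ σ' τ} → Included (S ⊕ σ) (S' ⊕ τ) → Step S (M , σ) (M' , σ') →
  Σ (List (Region × Tm 0)) λ δ → (σ' ≡ δ ++ σ) × Step S' (M , τ) (M' , δ ++ τ)
simulate i (β v) = [] , refl , β v
simulate i (getr m) = [] , refl , getr (i _ _ m)
simulate i (setr {r} {V} v) = (r , V) ∷ [] , refl , setr v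
simulate i (appL s) with simulate i s
... | δ , refl , s' = δ , refl , appL s'
simulate i (appR v s) with simulate i s
... | δ , refl , s' = δ , refl , appR v s'
simulate i (getE s) with simulate i s
... | δ , refl , s' = δ , refl , getE s'
simulate i (setL s) with simulate i s
... | δ , refl , s' = δ , refl , setL s'
simulate i (setR v s) with simulate i s
... | δ , refl , s' = δ , refl , setR v s'

acc-included : ∀ {S S' M σ τ} → Acc (Rd S) (M , σ) → Included (S' ⊕ τ) (S ⊕ σ) →
  Acc (Rd S') (M , τ)
acc-included {τ = τ} (acc rs) i = acc λ { {M' , τ'} s → next s }
  where
  next : ∀ {M' τ'} → Step _ (_ , τ) (M' , τ') → Acc (Rd _) (M' , τ')
  next s with simulate i s
  ... | δ , refl , s' = acc-included (rs s') (included-++ δ i)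

irreducible-included : ∀ {S S' M σ τ} → Irreducible S (M , σ) → Included (S' ⊕ τ) (S ⊕ σ) →
  Irreducible S' (M , τ)
irreducible-included irr i (M' , τ') s with simulate i s
... | δ , refl , s' = irr _ s'

star-included : ∀ {S S' M M' σ σ₁ τ} → Star (Step S) (M , σ) (M' , σ₁) → Included (S ⊕ σ) (S' ⊕ τ) →
  Σ (List (Region × Tm 0)) λ δ → (σ₁ ≡ δ ++ σ) × Star (Step S') (M , τ) (M' , δ ++ τ)
star-included ε i = [] , refl , ε
star-included {σ = σ} {τ = τ} (_◅_ {j = _ , _} s ss) i with simulate i s
... | δ , refl , s' with star-included ss (included-++ δ i)
... | δ' , refl , ss' =
  δ' ++ δ , sym (++-assoc δ' δ σ) ,
  ≡subst (λ x → Star (Step _) (_ , τ) (_ , x)) (sym (++-assoc δ' δ τ)) (s' ◅ ss')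

≐-trans : ∀ {S S' S''} → S ≐ S' → S' ≐ S'' → S ≐ S''
≐-trans p q r V = q r V ⇔-∘ p r V

≐-sym : ∀ {S S'} → S ≐ S' → S' ≐ S
≐-sym p r V = ⇔-sym (p r V)

≐-++ : ∀ {S σ τ} δ → (S ⊕ σ) ≐ (S ⊕ τ) → (S ⊕ (δ ++ σ)) ≐ (S ⊕ (δ ++ τ))
≐-++ δ p r V = mk⇔ (included-++ δ (λ r V → to (p r V)) r V)
                   (included-++ δ (λ r V → from (p r V)) r V)

⊕-[] : ∀ {S} → (S ⊕ []) ≐ S
⊕-[] r V = mk⇔ (λ { (inj₁ x) → x ; (inj₂ ()) }) inj₁

≐-unchanged : ∀ {S σ τ} → (S ⊕ σ) ≐ S → (S ⊕ τ) ≐ S → (S ⊕ σ) ≐ (S ⊕ τ)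
≐-unchanged p q = ≐-trans p (≐-sym q)

eval-≐ : ∀ {S M σ τ Q} → Eval S (M , σ) Q → (S ⊕ σ) ≐ (S ⊕ τ) → Eval S (M , τ) Q
eval-≐ {σ = σ} {τ} (a , P) eq = acc-included a (λ r V → from (eq r V)) , λ M' τ' ss irr → result ss irr
  where
  result : ∀ {M' τ'} → Star (Step _) (_ , τ) (M' , τ') → Irreducible _ (M' , τ') → _
  result ss irr with star-included ss (λ r V → from (eq r V))
  ... | δ , refl , ss' with P _ _ ss' (irreducible-included irr (λ r V → to (≐-++ δ eq r V)))
  ... | e , q = ≐-trans (≐-++ δ (≐-sym eq)) e , q

data Frame : Set where
  fappL : Tm 0 → Frame
  fappR : (V : Tm 0) → Value V → Frame
  fget  : Frame
  fsetL : Tm 0 → Frame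
  fsetR : (V : Tm 0) → Value V → Frame

plug : Frame → Tm 0 → Tm 0
plug (fappL N) M = app M N
plug (fappR V _) M = app V M
plug fget M = get M
plug (fsetL N) M = set M N
plug (fsetR V _) M = set V M

plug-step : ∀ {S M M' σ σ'} F → Step S (M , σ) (M' , σ') → Step S (plug F M , σ) (plug F M' , σ')
plug-step (fappL N) s = appL s
plug-step (fappR V v) s = appR v s
plug-step fget s = getE s
plug-step (fsetL N) s = setL s
plug-step (fsetR V v) s = setR v s

plug-inversion : ∀ {S M σ c'} F → ¬ Value M → Step S (plug F M , σ) c' →
  Σ Conf λ c → (c' ≡ (plug F (proj₁ c) , proj₂ c)) × Step S (M , σ) c
plug-inversion (fappL N) nv (β v) = ⊥-elim (nv (lam _))
plug-inversion (fappL N) nv (appL s) = _ , refl , s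
plug-inversion (fappL N) nv (appR v s) = ⊥-elim (nv v)
plug-inversion (fappR V w) nv (β v) = ⊥-elim (nv v)
plug-inversion (fappR V w) nv (appL s) = ⊥-elim (value-irreducible w _ s)
plug-inversion (fappR V w) nv (appR v s) = _ , refl , s
plug-inversion fget nv (getr _) = ⊥-elim (nv (reg _))
plug-inversion fget nv (getE s) = _ , refl , s
plug-inversion (fsetL N) nv (setr _) = ⊥-elim (nv (reg _))
plug-inversion (fsetL N) nv (setL s) = _ , refl , s
plug-inversion (fsetL N) nv (setR v s) = ⊥-elim (nv v)
plug-inversion (fsetR V w) nv (setr v) = ⊥-elim (nv v)
plug-inversion (fsetR V w) nv (setL s) = ⊥-elim (value-irreducible w _ s)
plug-inversion (fsetR V w) nv (setR v s) = _ , refl , s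

eval-bind : ∀ {S : Store} {Q Q' : Tm 0 → Set} {M : Tm 0} {σ} F →
  Eval S (M , σ) Q → (∀ {V} → Q V → Value V) →
  (∀ V σ' → Star (Step S) (M , σ) (V , σ') → Value V → Q V → (S ⊕ σ') ≐ S →
     Eval S (plug F V , σ') Q') →
  Eval S (plug F M , σ) Q'
eval-bind {S} {Q} {Q'} F (a , P) isValue = bind a P
  where
  bind : ∀ {M σ} → Acc (Rd S) (M , σ) →
    (∀ M' σ' → Star (Step S) (M , σ) (M' , σ') → Irreducible S (M' , σ') → ((S ⊕ σ') ≐ S) × Q M') →
    (∀ V σ' → Star (Step S) (M , σ) (V , σ') → Value V → Q V → (S ⊕ σ') ≐ S →
       Eval S (plug F V , σ') Q') →
    Eval S (plug F M , σ) Q'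
  bind {M} {σ} (acc rs) P k with value? M
  ... | inj₁ v = k M σ ε v (proj₂ (P M σ ε (value-irreducible v))) (proj₁ (P M σ ε (value-irreducible v)))
  ... | inj₂ nv = acc (λ s → proj₁ (after s)) , results
    where
    continue : ∀ {c} → Step S (M , σ) c → Eval S (plug F (proj₁ c) , proj₂ c) Q'
    continue s = bind (rs s) (λ M' σ' ss → P M' σ' (s ◅ ss)) (λ V σ' ss → k V σ' (s ◅ ss))
    after : ∀ {c'} → Step S (plug F M , σ) c' → Eval S c' Q'
    after s with plug-inversion F nv s
    ... | c , refl , s' = continue s'
    results : ∀ M' σ' → Star (Step S) (plug F M , σ) (M' , σ') → Irreducible S (M' , σ') →
      ((S ⊕ σ') ≐ S) × Q' M'
    -- were F[M] irreducible, so would be the non-value M, whose result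
    -- nevertheless satisfies Q and hence is a value
    results M' σ' ε irr = ⊥-elim (nv (isValue (proj₂ (P M σ ε (λ c s → irr _ (plug-step F s))))))
    results M' σ' (s ◅ ss) irr = proj₂ (after s) M' σ' ss irr

-- The logical relation ⟦ R ⊢ A , e ⟧: basic properties

sem-eval : ∀ {R A e R' M R''} → ⟦ R ⊢ A , e ⟧ R' M → R'' ≥ R' →
  Eval (⟦ R ⟧ᶜ R'') (M , []) (𝒞 A R R'')
sem-eval {R'' = R''} (_ , _ , sn , ev) g = sn R'' g , λ M' σ' ss irr → ev R'' g M' σ' (ss , irr)

sem-intro : ∀ {R A e R' M} → R' ≥ R → R' ⨾ [] ⊢ M ∶ A , e →
  (∀ R'' → R'' ≥ R' → Eval (⟦ R ⟧ᶜ R'') (M , []) (𝒞 A R R'')) → ⟦ R ⊢ A , e ⟧ R' M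
sem-intro g t ev = g , t , (λ R'' g'' → proj₁ (ev R'' g'')) ,
  λ R'' g'' M' σ (ss , irr) → proj₂ (ev R'' g'') M' σ ss irr

sem-typed : ∀ {R A e R' M} → ⟦ R ⊢ A , e ⟧ R' M → R' ⨾ [] ⊢ M ∶ A , e
sem-typed (_ , t , _) = t

sem-≥ : ∀ {R A e R' M} → ⟦ R ⊢ A , e ⟧ R' M → R' ≥ R
sem-≥ (g , _) = g

𝒞-mono : ∀ {A R R'' R''' M'} → 𝒞 A R R'' M' → R''' ≥ R'' → 𝒞 A R R''' M'
𝒞-mono {𝟙} c g = c
𝒞-mono {Reg r A} c g = c
𝒞-mono {A ⟶[ e ] B} (N , eq , h) g = N , eq , λ R₁ g₁ → h R₁ (≥-trans g₁ g)

𝒞⇒Value : ∀ {A R R'' M'} → 𝒞 A R R'' M' → Value M'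
𝒞⇒Value {𝟙} refl = unit
𝒞⇒Value {Reg r A} refl = reg r
𝒞⇒Value {A ⟶[ e ] B} (N , refl , _) = lam N

sem-mono : ∀ {R A e R' R₂ M} → ⟦ R ⊢ A , e ⟧ R' M → R₂ ≥ R' → ⟦ R ⊢ A , e ⟧ R₂ M
sem-mono s g = sem-intro (≥-trans g (sem-≥ s)) (⊢-≥ g (sem-typed s)) (λ R'' g'' → sem-eval s (≥-trans g'' g))

sem-value : ∀ {R A e R' V} → Value V → R' ≥ R → R' ⨾ [] ⊢ V ∶ A , e →
  (∀ R'' → R'' ≥ R' → 𝒞 A R R'' V) → ⟦ R ⊢ A , e ⟧ R' V
sem-value v g t c = sem-intro g t (λ R'' g'' → eval-value v (c R'' g'') ⊕-[])

mutual
  sem-sub : ∀ {R A A' e e' R' M} → R ⊢ A ≤ A' → e ⊆ e' → e' ⊆ dom R →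
    ⟦ R ⊢ A , e ⟧ R' M → ⟦ R ⊢ A' , e' ⟧ R' M
  sem-sub le s d sm@(g , t , _) =
    sem-intro g (t-sub t (≤-≥ g le , s , ⊆dom-≥ g d))
      (λ R'' g'' → eval-map (𝒞-sub le (≥-trans g'' g)) (sem-eval sm g''))

  𝒞-sub : ∀ {R A A' R'' M'} → R ⊢ A ≤ A' → R'' ≥ R → 𝒞 A R R'' M' → 𝒞 A' R R'' M'
  𝒞-sub (≤-refl _) g c = c
  𝒞-sub (≤-⟶ a b s d) g (N , eq , h) =
    N , eq , λ R₁ g₁ V v sV → sem-sub b s d (h R₁ g₁ V v (sem-sub a ⊆-[] ⊆-[] sV))

-- Every well-formed type is semantically inhabited by a canonical value
-- (the constant function for arrows).  This is what makes the stores
-- ⟦ R ⟧ᶜ R'' non-empty at every region, so that reads never get stuck.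

canonical : ∀ {n} → Ty → Tm n
canonical 𝟙 = unit
canonical (Reg r A) = reg r
canonical (A ⟶[ e ] B) = lam (canonical B)

canonical-value : ∀ {n} A → Value {n} (canonical A)
canonical-value 𝟙 = unit
canonical-value (Reg r A) = reg r
canonical-value (A ⟶[ e ] B) = lam _

canonical-closed : ∀ {m n} (σ : Fin m → Tm n) A → subst σ (canonical A) ≡ canonical A
canonical-closed σ 𝟙 = refl
canonical-closed σ (Reg r A) = refl
canonical-closed σ (A ⟶[ e ] B) = cong lam (canonical-closed (exts σ) B)

canonical-typed : ∀ {n R A} {Γ : Vec Ty n} → WFTy R A → WFEnv R Γ → R ⨾ Γ ⊢ canonical A ∶ A , []
canonical-typed (wf-𝟙 w) env = t-unit env
canonical-typed (wf-Reg w m) env = t-reg env m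
canonical-typed (wf-⟶ a b s) env =
  t-lam (t-sub (canonical-typed b (proj₁ env , (a ∷ proj₂ env))) (≤-refl b , ⊆-[] , s))

canonical-𝒞 : ∀ {R A R''} → WFTy R A → R'' ≥ R → 𝒞 A R R'' (canonical A)
canonical-𝒞 (wf-𝟙 w) g = refl
canonical-𝒞 (wf-Reg w m) g = refl
canonical-𝒞 {A = A ⟶[ e ] B} wa@(wf-⟶ a b s) g = canonical B , refl , λ R₁ g₁ V v sV →
  let g₁' = ≥-trans g₁ g in
  sem-intro g₁'
    (t-sub (t-app (canonical-typed (WFTy-≥ g₁' wa) (proj₁ g₁ , [])) (sem-typed sV))
           (≤-refl (WFTy-≥ g₁' b) , ⊆-++ id ⊆-[] , ⊆dom-≥ g₁' s))
    (λ R₂ g₂ → eval-β v (≡subst (λ Z → Eval _ (Z , []) _) (sym (canonical-closed _ B))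
                 (eval-value (canonical-value B) (canonical-𝒞 b (≥-trans g₂ g₁')) ⊕-[])))

canonical-sem : ∀ {R A R'} → WFTy R A → R' ≥ R → ⟦ R ⊢ A , [] ⟧ R' (canonical A)
canonical-sem a g = sem-value (canonical-value _) g (canonical-typed (WFTy-≥ g a) (proj₁ g , []))
  (λ R'' g'' → canonical-𝒞 a (≥-trans g'' g))

-- By effect locality, a well-typed term of effect e evaluates in the same way
-- over two well-typed initial stores that agree on the regions of e.
eval-transfer : ∀ {R T₀ T A e M σ Q} → WFCtx R → StoreOK R T₀ → StoreOK R T →
  AgreeOn e T₀ T → AgreeOn e T T₀ → R ⨾ [] ⊢ M ∶ A , e → Writes R e σ →
  Eval T₀ (M , σ) Q → Eval T (M , σ) Q
eval-transfer {R} {T₀} {T} {A} {e} {Q = Q} w st₀ st ag₀ ag t d (a , P) = terminates a t d , results P t d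
  where
  terminates : ∀ {M σ} → Acc (Rd T₀) (M , σ) → R ⨾ [] ⊢ M ∶ A , e → Writes R e σ → Acc (Rd T) (M , σ)
  terminates {M} {σ} (acc rs) t d = acc λ { {M' , σ'} s → next s }
    where
    next : ∀ {M' σ'} → Step T (M , σ) (M' , σ') → Acc (Rd T) (M' , σ')
    next s with subject-reduction w t (storeOK-⊕ st d) s
    ... | reduct t' δ refl d' replay = terminates (rs (replay T₀ ag)) t' (writes-++ d' d)

  irreducible₀ : ∀ {M σ} → R ⨾ [] ⊢ M ∶ A , e → Writes R e σ →
    Irreducible T (M , σ) → Irreducible T₀ (M , σ)
  irreducible₀ t d irr (M' , σ') s with subject-reduction w t (storeOK-⊕ st₀ d) s
  ... | reduct _ _ refl _ replay = irr _ (replay T ag₀)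

  results : ∀ {M σ} →
    (∀ M' σ' → Star (Step T₀) (M , σ) (M' , σ') → Irreducible T₀ (M' , σ') → ((T₀ ⊕ σ') ≐ T₀) × Q M') →
    R ⨾ [] ⊢ M ∶ A , e → Writes R e σ →
    ∀ M' σ' → Star (Step T) (M , σ) (M' , σ') → Irreducible T (M' , σ') → ((T ⊕ σ') ≐ T) × Q M'
  results {M} {σ} P t d .M .σ ε irr with P M σ ε (irreducible₀ t d irr)
  -- the writes σ go to regions of e, where T₀ and T agree
  ... | eq₀ , q = (λ r V → mk⇔ (λ { (inj₁ x) → x
                                  ; (inj₂ m) → ag₀ r V (proj₁ (d r V m)) (to (eq₀ r V) (inj₂ m)) })
                              inj₁) , q
  results P t d M' σ' (_◅_ {j = _ , _} s ss) irr with subject-reduction w t (storeOK-⊕ st d) s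
  ... | reduct t' δ refl d' replay =
    results (λ M'' σ'' ss' irr' → P M'' σ'' (replay T₀ ag ◅ ss') irr') t' (writes-++ d' d) M' σ' ss irr

-- The store interpretation ⟦ R ⟧ᶜ
--
-- The value set of region rᵢ is interpreted relative to the prefix R_{rᵢ}
-- of R; membership is invariant under extending that prefix (for types and
-- effects well formed in it), so it can be read relative to all of R.

prefix : ∀ {r A R} → r ∶ A ∈ᴿ R → Ctx
prefix {R = R ▸ _ ∶ _} here = R
prefix (there m) = prefix m

suffix : ∀ {r A R} → r ∶ A ∈ᴿ R → Ctx
suffix {r} {A} here = ε ▸ r ∶ A
suffix (there {s = s} {B} m) = suffix m ▸ s ∶ B

prefix-split : ∀ {r A R} (m : r ∶ A ∈ᴿ R) → R ≡ (prefix m ,, suffix m)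
prefix-split here = refl
prefix-split (there {s = s} {B} m) = cong (λ Z → Z ▸ s ∶ B) (prefix-split m)

prefix-≥ : ∀ {r A R} → WFCtx R → (m : r ∶ A ∈ᴿ R) → R ≥ prefix m
prefix-≥ w m = w , suffix m , prefix-split m

prefix-WF : ∀ {r A R} → WFCtx R → (m : r ∶ A ∈ᴿ R) → WFTy (prefix m) A
prefix-WF (wf-▸ a _) here = a
prefix-WF (wf-▸ a _) (there m) = prefix-WF (WFTy⇒WFCtx a) m

-- Regions of R₀ are fresh for a well-formed extension Y, so the stores of
-- R₀ and R₀ ,, Y coincide on dom R₀.
fresh : ∀ {R₀ r} Y → WFCtx (R₀ ,, Y) → r ∈ dom R₀ → r ∉ dom Y
fresh (Y ▸ s ∶ B) (wf-▸ a f) m (here refl) = f (dom-wk Y m)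
fresh (Y ▸ s ∶ B) (wf-▸ a f) m (there n) = fresh Y (WFTy⇒WFCtx a) m n

⟦⟧ᶜ-prefix : ∀ {R₀ R X r V} → R ≥ R₀ → r ∈ dom R₀ → ⟦ R ⟧ᶜ X r V ≡ ⟦ R₀ ⟧ᶜ X r V
⟦⟧ᶜ-prefix {R₀} (w , Y , refl) m = skip Y (fresh Y w m)
  where
  skip : ∀ Y {X r V} → r ∉ dom Y → ⟦ R₀ ,, Y ⟧ᶜ X r V ≡ ⟦ R₀ ⟧ᶜ X r V
  skip ε f = refl
  skip (Y ▸ s ∶ B) {r = r} f with r ≟ s
  ... | yes refl = ⊥-elim (f (here refl))
  ... | no _ = skip Y (f ∘ there)

store-lookup : ∀ R {X r V} → ⟦ R ⟧ᶜ X r V →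
  Σ Ty λ A → Σ (r ∶ A ∈ᴿ R) λ m → Value V × ⟦ prefix m ⊢ A , [] ⟧ X V
store-lookup ε ()
store-lookup (R ▸ s ∶ B) {r = r} x with r ≟ s
store-lookup (R ▸ s ∶ B) (v , p) | yes refl = B , here , v , p
store-lookup (R ▸ s ∶ B) x | no _ with store-lookup R x
... | A , m , v , p = A , there m , v , p

store-insert : ∀ {R X r A V} → WFCtx R → (m : r ∶ A ∈ᴿ R) → Value V →
  ⟦ prefix m ⊢ A , [] ⟧ X V → ⟦ R ⟧ᶜ X r V
store-insert {r = r} w here v p with r ≟ r
... | yes refl = v , p
... | no ne = ⊥-elim (ne refl)
store-insert {r = r} (wf-▸ a f) (there {s = s} m) v p with r ≟ s
... | yes refl = ⊥-elim (f (∈ᴿ⇒dom m))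
... | no _ = store-insert (WFTy⇒WFCtx a) m v p

storeOK-⟦⟧ᶜ : ∀ {R R''} → R'' ≥ R → StoreOK R'' (⟦ R ⟧ᶜ R'')
storeOK-⟦⟧ᶜ {R} g r V x with store-lookup R x
... | A , m , v , p = v , A , ∈ᴿ-≥ g m , sem-typed p

mutual
  sem-weaken : ∀ {R₀ R A e R' M} → R ≥ R₀ → WFTy R₀ A → e ⊆ dom R₀ → R' ≥ R →
    ⟦ R₀ ⊢ A , e ⟧ R' M → ⟦ R ⊢ A , e ⟧ R' M
  sem-weaken h a s g sm = sem-intro g (sem-typed sm) λ R'' g'' →
    let g₂ = ≥-trans g'' g in
    eval-map (𝒞-weaken h a g₂)
      (eval-transfer (proj₁ g₂) (storeOK-⟦⟧ᶜ (≥-trans g₂ h)) (storeOK-⟦⟧ᶜ g₂)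
        (λ r V m → ≡subst id (sym (⟦⟧ᶜ-prefix h (s m))))
        (λ r V m → ≡subst id (⟦⟧ᶜ-prefix h (s m)))
        (⊢-≥ g'' (sem-typed sm)) writes-[] (sem-eval sm g''))

  sem-strengthen : ∀ {R₀ R A e R' M} → R ≥ R₀ → WFTy R₀ A → e ⊆ dom R₀ → R' ≥ R →
    ⟦ R ⊢ A , e ⟧ R' M → ⟦ R₀ ⊢ A , e ⟧ R' M
  sem-strengthen h a s g sm = sem-intro (≥-trans g h) (sem-typed sm) λ R'' g'' →
    let g₂ = ≥-trans g'' g in
    eval-map (𝒞-strengthen h a g₂)
      (eval-transfer (proj₁ g₂) (storeOK-⟦⟧ᶜ g₂) (storeOK-⟦⟧ᶜ (≥-trans g₂ h))
        (λ r V m → ≡subst id (⟦⟧ᶜ-prefix h (s m)))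
        (λ r V m → ≡subst id (sym (⟦⟧ᶜ-prefix h (s m))))
        (⊢-≥ g'' (sem-typed sm)) writes-[] (sem-eval sm g''))

  𝒞-weaken : ∀ {R₀ R A R'' M'} → R ≥ R₀ → WFTy R₀ A → R'' ≥ R →
    𝒞 A R₀ R'' M' → 𝒞 A R R'' M'
  𝒞-weaken h (wf-𝟙 _) g c = c
  𝒞-weaken h (wf-Reg _ _) g c = c
  𝒞-weaken h (wf-⟶ a b s) g (N , eq , f) = N , eq , λ R₁ g₁ V v sV →
    sem-weaken h b s (≥-trans g₁ g) (f R₁ g₁ V v (sem-strengthen h a ⊆-[] (≥-trans g₁ g) sV))

  𝒞-strengthen : ∀ {R₀ R A R'' M'} → R ≥ R₀ → WFTy R₀ A → R'' ≥ R →
    𝒞 A R R'' M' → 𝒞 A R₀ R'' M'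
  𝒞-strengthen h (wf-𝟙 _) g c = c
  𝒞-strengthen h (wf-Reg _ _) g c = c
  𝒞-strengthen h (wf-⟶ a b s) g (N , eq , f) = N , eq , λ R₁ g₁ V v sV →
    sem-strengthen h b s (≥-trans g₁ g) (f R₁ g₁ V v (sem-weaken h a ⊆-[] (≥-trans g₁ g) sV))

store-read : ∀ {R r A R'' V} → r ∶ A ∈ᴿ R → R'' ≥ R → ⟦ R ⟧ᶜ R'' r V → ⟦ R ⊢ A , [] ⟧ R'' V
store-read {R} m g x with store-lookup R x
... | A' , m' , v , p with ∈ᴿ-unique (≥⇒WFCtx g) m m'
... | refl = sem-weaken (prefix-≥ w m') (prefix-WF w m') ⊆-[] g p
  where w = ≥⇒WFCtx g

store-write : ∀ {R r A R'' V} → r ∶ A ∈ᴿ R → R'' ≥ R → Value V → ⟦ R ⊢ A , [] ⟧ R'' V → ⟦ R ⟧ᶜ R'' r V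
store-write m g v p =
  store-insert w m v (sem-strengthen (prefix-≥ w m) (prefix-WF w m) ⊆-[] g p)
  where w = ≥⇒WFCtx g

result-sem : ∀ {R R'' A e N W σ₁ σ₂} → R'' ≥ R → R'' ⨾ [] ⊢ N ∶ A , e →
  ((⟦ R ⟧ᶜ R'' ⊕ σ₁) ≐ ⟦ R ⟧ᶜ R'') → Star (Step (⟦ R ⟧ᶜ R'')) (N , σ₁) (W , σ₂) →
  Value W → 𝒞 A R R'' W → ⟦ R ⊢ A , [] ⟧ R'' W
result-sem g t eq ss w q =
  sem-value w g (⊢-value w (subject-reduction* (proj₁ g) t storeOK ss)) (λ R₃ g₃ → 𝒞-mono q g₃)
  where
  storeOK : StoreOK _ _
  storeOK r V x = storeOK-⟦⟧ᶜ g r V (to (eq r V) x)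

⟶-WF : ∀ {R A B e} → WFTy R (A ⟶[ e ] B) → WFTy R B × e ⊆ dom R
⟶-WF (wf-⟶ _ b s) = b , s

compat-lam : ∀ {R R₁ Q A B e} → R₁ ≥ R → R₁ ⨾ [] ⊢ lam Q ∶ A ⟶[ e ] B , [] →
  (∀ R₂ → R₂ ≥ R₁ → ∀ V → Value V → ⟦ R ⊢ A , [] ⟧ R₂ V → ⟦ R ⊢ B , e ⟧ R₂ (Q ⟨ V ⟩)) →
  ⟦ R ⊢ A ⟶[ e ] B , [] ⟧ R₁ (lam Q)
compat-lam {Q = Q} g t body = sem-value (lam Q) g t λ R'' g'' → Q , refl , λ R₂ g₂ V v sV →
  let g₂' = ≥-trans g₂ g''
      wfB , e⊆R₂ = ⟶-WF (proj₁ (⊢⇒WFTyE (⊢-≥ g₂' t)))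
  in sem-intro (≥-trans g₂' g)
       (t-sub (t-app (⊢-≥ g₂' t) (sem-typed sV)) (≤-refl wfB , ⊆-++ id ⊆-[] , e⊆R₂))
       (λ R₃ g₃ → eval-β v (sem-eval (body R₂ g₂' V v sV) g₃))

compat-app : ∀ {R R₁ M N A B e₁ e₂ e₃} → ⟦ R ⊢ A ⟶[ e₂ ] B , e₁ ⟧ R₁ M → ⟦ R ⊢ A , e₃ ⟧ R₁ N →
  ⟦ R ⊢ B , e₁ ++ e₂ ++ e₃ ⟧ R₁ (app M N)
compat-app {N = N} semM semN =
  sem-intro (sem-≥ semM) (t-app (sem-typed semM) (sem-typed semN)) λ R'' g'' →
    let R''≥R = ≥-trans g'' (sem-≥ semM)
        R''≥R'' = ≥-refl (proj₁ g'')
    in eval-bind (fappL N) (sem-eval semM g'') 𝒞⇒Value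
       λ { V σ₁ _ _ (P , refl , fun) eq₁ →
         eval-bind (fappR (lam P) (lam P)) (eval-≐ (sem-eval semN g'') (≐-unchanged ⊕-[] eq₁)) 𝒞⇒Value
         λ W σ₂ ss w qW eq₂ →
           let semW = result-sem R''≥R (⊢-≥ g'' (sem-typed semN)) eq₁ ss w qW
           in eval-≐ (sem-eval (fun R'' R''≥R'' W w semW) R''≥R'') (≐-unchanged ⊕-[] eq₂) }

-- After evaluating the reference, get(r) reads a related value, and there
-- is always one to read.
compat-get : ∀ {R R₁ M r A e} → r ∶ A ∈ᴿ R → ⟦ R ⊢ Reg r A , e ⟧ R₁ M →
  ⟦ R ⊢ A , e ++ [ r ] ⟧ R₁ (get M)
compat-get {R} {r = r} {A} mem semM = sem-intro (sem-≥ semM) (t-get (sem-typed semM)) λ R'' g'' →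
  let R''≥R = ≥-trans g'' (sem-≥ semM)
  in eval-bind fget (sem-eval semM g'') (𝒞⇒Value {Reg r A} {R} {R''})
     λ { V σ₁ _ _ refl eq₁ → eval-expand (read R''≥R eq₁) (_ , getr (inj₁ (stored R''≥R))) }
  where
  stored : ∀ {R''} → R'' ≥ R → ⟦ R ⟧ᶜ R'' r (canonical A)
  stored g = store-write mem g (canonical-value A) (canonical-sem (∈ᴿ-WF (≥⇒WFCtx g) mem) g)
  read : ∀ {R'' σ₁} → R'' ≥ R → ((⟦ R ⟧ᶜ R'' ⊕ σ₁) ≐ ⟦ R ⟧ᶜ R'') →
    ∀ {c'} → Step (⟦ R ⟧ᶜ R'') (get (reg r) , σ₁) c' → Eval (⟦ R ⟧ᶜ R'') c' (𝒞 A R R'')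
  read g eq₁ (getr {V = W} x) =
    eval-≐ (sem-eval (store-read mem g (to (eq₁ r W) x)) (≥-refl (proj₁ g))) (≐-unchanged ⊕-[] eq₁)
  read g eq₁ (getE ())

-- After evaluating both arguments, set(r, W) writes a related value W,
-- which the interpreted store already contains: the store is unchanged.
compat-set : ∀ {R R₁ M N r A e₁ e₂} → r ∶ A ∈ᴿ R → ⟦ R ⊢ Reg r A , e₁ ⟧ R₁ M → ⟦ R ⊢ A , e₂ ⟧ R₁ N →
  ⟦ R ⊢ 𝟙 , e₁ ++ e₂ ++ [ r ] ⟧ R₁ (set M N)
compat-set {R} {N = N} {r} {A} mem semM semN =
  sem-intro (sem-≥ semM) (t-set (sem-typed semM) (sem-typed semN)) λ R'' g'' →
    let R''≥R = ≥-trans g'' (sem-≥ semM)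
    in eval-bind (fsetL N) (sem-eval semM g'') (𝒞⇒Value {Reg r A} {R} {R''})
       λ { V σ₁ _ _ refl eq₁ →
         eval-bind (fsetR (reg r) (reg r)) (eval-≐ (sem-eval semN g'') (≐-unchanged ⊕-[] eq₁)) 𝒞⇒Value
         λ W σ₂ ss w qW eq₂ →
           let present = store-write mem R''≥R w (result-sem R''≥R (⊢-≥ g'' (sem-typed semN)) eq₁ ss w qW)
           in eval-expand (write eq₂ w present) (_ , setr w) }
  where
  write : ∀ {S : Store} {σ₂ W} → ((S ⊕ σ₂) ≐ S) → Value W → S r W →
    ∀ {c'} → Step S (set (reg r) W , σ₂) c' → Eval S c' (λ M' → M' ≡ unit)
  write eq₂ w present (setr _) = eval-value unit refl
    (λ r' V' → mk⇔ (λ { (inj₁ x) → x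
                      ; (inj₂ (here refl)) → present
                      ; (inj₂ (there m)) → to (eq₂ r' V') (inj₂ m) }) inj₁)
  write eq₂ w present (setL ())
  write eq₂ w present (setR _ s) = ⊥-elim (value-irreducible w _ s)

SemEnv : ∀ {n} → Ctx → Ctx → Vec Ty n → (Fin n → Tm 0) → Set
SemEnv R R₁ Γ γ = ∀ i → Value (γ i) × ⟦ R ⊢ lookup Γ i , [] ⟧ R₁ (γ i)

env-extend : ∀ {n R R₁ R₂ A} {Γ : Vec Ty n} {γ V} → SemEnv R R₁ Γ γ → R₂ ≥ R₁ →
  Value V → ⟦ R ⊢ A , [] ⟧ R₂ V → SemEnv R R₂ (A ∷ Γ) (V • γ)
env-extend env g v sV zero = v , sV
env-extend env g v sV (suc i) = proj₁ (env i) , sem-mono (proj₂ (env i)) g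

closing-typed : ∀ {n R R₁} {Γ : Vec Ty n} {γ M A e} → R ⨾ Γ ⊢ M ∶ A , e → R₁ ≥ R →
  SemEnv R R₁ Γ γ → R₁ ⨾ [] ⊢ subst γ M ∶ A , e
closing-typed t g env = ⊢-subst (λ i → sem-typed (proj₂ (env i))) (proj₁ g , []) (⊢-≥ g t)

fundamental : ∀ {n R} {Γ : Vec Ty n} {M A e} → R ⨾ Γ ⊢ M ∶ A , e →
  ∀ R₁ → R₁ ≥ R → (γ : Fin n → Tm 0) → SemEnv R R₁ Γ γ → ⟦ R ⊢ A , e ⟧ R₁ (subst γ M)
fundamental (t-var {i = i} _) R₁ g γ env = proj₂ (env i)
fundamental t@(t-reg _ _) R₁ g γ env = sem-value (reg _) g (closing-typed t g env) (λ _ _ → refl)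
fundamental t@(t-unit _) R₁ g γ env = sem-value unit g (closing-typed t g env) (λ _ _ → refl)
fundamental {R = R} t@(t-lam {M = P} {B} {e} tP) R₁ g γ env =
  compat-lam g (closing-typed t g env) λ R₂ g₂ V v sV →
    ≡subst (⟦ R ⊢ B , e ⟧ R₂) (sym (subst-β γ P V))
      (fundamental tP R₂ (≥-trans g₂ g) (V • γ) (env-extend env g₂ v sV))
fundamental (t-app tM tN) R₁ g γ env =
  compat-app (fundamental tM R₁ g γ env) (fundamental tN R₁ g γ env)
fundamental (t-get tM) R₁ g γ env = compat-get (⊢Reg⇒∈ᴿ tM) (fundamental tM R₁ g γ env)
fundamental (t-set tM tN) R₁ g γ env =
  compat-set (⊢Reg⇒∈ᴿ tM) (fundamental tM R₁ g γ env) (fundamental tN R₁ g γ env)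
fundamental (t-sub t (le , s , d)) R₁ g γ env = sem-sub le s d (fundamental t R₁ g γ env)

typed⇒sem : ∀ {R M A e} → R ⨾ [] ⊢ M ∶ A , e → ⟦ R ⊢ A , e ⟧ R M
typed⇒sem {R} {M} {A} {e} t = ≡subst (⟦ R ⊢ A , e ⟧ R) (subst-closed (λ ()) M)
  (fundamental t R (≥-refl (⊢⇒WFCtx t)) (λ ()) (λ ()))

-- Termination of multi-threaded programs
--
-- Fix a well-formed R and the store S = ⟦ R ⟧ᶜ R.  Every value a well-typed
-- program writes is related, hence already in S; so each step of a thread
-- is simulated by a step of that thread alone over S.  Each thread is
-- strongly normalising over S by part (1), hence so is the list of threads
-- under steps of one thread at a time, and hence so is the program.

Typed : Ctx → Tm 0 → Set
Typed R M = Σ Ty λ A → Σ Effect λ e → R ⨾ [] ⊢ M ∶ A , e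

module Termination (R : Ctx) (w : WFCtx R) where

  S : Store
  S = ⟦ R ⟧ᶜ R

  ThreadStep : Tm 0 → Tm 0 → Set
  ThreadStep M M' = Σ (List (Region × Tm 0)) λ δ → Step S (M , []) (M' , δ)

  thread-acc : ∀ {M τ} → Acc (Rd S) (M , τ) → Acc (λ N N' → ThreadStep N' N) M
  thread-acc {M} {τ} (acc rs) = acc λ { (_ , s) → next s }
    where
    next : ∀ {M' δ} → Step S (M , []) (M' , δ) → Acc (λ N N' → ThreadStep N' N) M'
    next s with simulate {τ = τ} (λ { r V (inj₁ x) → inj₁ x ; r V (inj₂ ()) }) s
    ... | _ , _ , s' = thread-acc (rs s')

  data ListStep : List (Tm 0) → List (Tm 0) → Set where
    lhere  : ∀ {M M' Ns} → ThreadStep M M' → ListStep (M ∷ Ns) (M' ∷ Ns)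
    lthere : ∀ {M Ns Ns'} → ListStep Ns Ns' → ListStep (M ∷ Ns) (M ∷ Ns')

  ListRd : List (Tm 0) → List (Tm 0) → Set
  ListRd Ns Ns' = ListStep Ns' Ns

  acc-cons : ∀ {M Ns} → Acc (λ N N' → ThreadStep N' N) M → Acc ListRd Ns → Acc ListRd (M ∷ Ns)
  acc-cons (acc rsM) (acc rsN) = acc λ { (lhere s) → acc-cons (rsM s) (acc rsN)
                                       ; (lthere s) → acc-cons (acc rsM) (rsN s) }

  threads-acc : ∀ {Ms} → All (Typed R) Ms → Acc ListRd Ms
  threads-acc A[] = acc λ ()
  threads-acc ((_ , _ , t) A∷ ts) =
    acc-cons (thread-acc (proj₁ (sem-eval (typed⇒sem t) (≥-refl w)))) (threads-acc ts)

  store-included : ∀ {σ} → StoreOK R (emptyStore ⊕ σ) → Included (emptyStore ⊕ σ) (S ⊕ [])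
  store-included st r V (inj₁ ())
  store-included st r V (inj₂ m) with st r V (inj₂ m)
  ... | v , A , mem , tV = inj₁ (store-write mem (≥-refl w) v (typed⇒sem tV))

  program-step : ∀ Ms {M M' Ns σ σ'} → All (Typed R) (Ms ++ M ∷ Ns) → StoreOK R (emptyStore ⊕ σ) →
    Step emptyStore (M , σ) (M' , σ') →
    ListStep (Ms ++ M ∷ Ns) (Ms ++ M' ∷ Ns) × All (Typed R) (Ms ++ M' ∷ Ns) × StoreOK R (emptyStore ⊕ σ')
  program-step [] ((A , e , t) A∷ ts) st s with subject-reduction w t st s | simulate (store-included st) s
  ... | reduct t' δ refl d _ | _ , _ , s' = lhere (_ , s') , ((A , e , t') A∷ ts) , storeOK-++ st d
  program-step (_ ∷ Ms) (tx A∷ ts) st s with program-step Ms ts st s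
  ... | l , ts' , st' = lthere l , (tx A∷ ts') , st'

  ProgramRd : PConf → PConf → Set
  ProgramRd c c' = PStep emptyStore c' c

  mutual
    program-acc : ∀ {Ms σ} → Acc ListRd Ms → All (Typed R) Ms → StoreOK R (emptyStore ⊕ σ) →
      Acc ProgramRd (Ms , σ)
    program-acc (acc rs) ts st = acc (λ p → program-acc-step p rs ts st)

    program-acc-step : ∀ {c c'} → PStep emptyStore c c' → (∀ {Ns} → ListStep (proj₁ c) Ns → Acc ListRd Ns) →
      All (Typed R) (proj₁ c) → StoreOK R (emptyStore ⊕ proj₂ c) → Acc ProgramRd c'
    program-acc-step (thread {Ms} s) rs ts st with program-step Ms ts st s
    ... | l , ts' , st' = program-acc (rs l) ts' st'

behaviour-threads : ∀ {R Ms e} → R ⊢ᴮ Ms , e → All (Typed R) Ms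
behaviour-threads (one t) = (_ , _ , t) A∷ A[]
behaviour-threads (cons t b) = (_ , _ , t) A∷ behaviour-threads b

behaviour-WFCtx : ∀ {R Ms e} → R ⊢ᴮ Ms , e → WFCtx R
behaviour-WFCtx (one t) = ⊢⇒WFCtx t
behaviour-WFCtx (cons t _) = ⊢⇒WFCtx t

behaviour⇒terminates : ∀ {R Ms e} → R ⊢ᴮ Ms , e → Terminates Ms
behaviour⇒terminates {R} {Ms} b = program-acc (threads-acc ts) ts (λ { r V (inj₁ ()) ; r V (inj₂ ()) })
  where
  open Termination R (behaviour-WFCtx b)
  ts : All (Typed R) Ms
  ts = behaviour-threads b

corollary1 : (∀ (R : Ctx) (M : Tm 0) (A : Ty) (e : Effect) →
                 (R ⨾ [] ⊢ M ∶ A , e) ⇔ ⟦ R ⊢ A , e ⟧ R M)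
             × (∀ (R : Ctx) (Ms : List (Tm 0)) (e : Effect) →
                 R ⊢ᴮ Ms , e → Terminates Ms)
corollary1 = (λ R M A e → mk⇔ typed⇒sem sem-typed) , (λ R Ms e → behaviour⇒terminates)
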